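{- Let $D$ be a digraph containing a spanning out-tree $T$. Then $D$ contains a final (spanning) out-tree.
   Context: An out-tree is an oriented graph with no cycles in which every vertex has in-degree at most $1$; it has a unique vertex of in-degree $0$, its root (source) $r$. For a spanning out-tree $T$ of $D$ and a vertex $x$, the level $l_T(x)$ is the number of vertices of the unique directed $r$–$x$ path in $T$. A vertex $y$ is an ancestor of $x$, written $y\leqslant_T x$, if $y$ lies on the $T$-path from $r$ to $x$. An arc $(x,y)$ of $D$ is forward with respect to $T$ if $l_T(x)<l_T(y)$ and backward otherwise. $T$ is a final out-tree of $D$ if for every backward arc $(x,y)$ of $D$ we have $y\leqslant_T x$. -}

module Defs where

open import Data.Nat using (ℕ; suc; _<_)
open import Data.Fin using (Fin)
open import Data.Bool using (Bool; true)
open import Data.Product using (Σ)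
open import Relation.Binary.PropositionalEquality using (_≡_; _≢_)
open import Relation.Nullary using (¬_)

Digraph : ℕ → Set
Digraph n = Fin n → Fin n → Bool

Arc : ∀ {n} → Digraph n → Fin n → Fin n → Set
Arc D x y = D x y ≡ true

module _ {n : ℕ} (r : Fin n) (parent : Fin n → Fin n) where

  data AncP (y : Fin n) : Fin n → Set where
    here : AncP y y
    step : ∀ {x} → x ≢ r → AncP y (parent x) → AncP y x

  data LevelP : Fin n → ℕ → Set where
    lroot : LevelP r 1
    lstep : ∀ {x k} → x ≢ r → LevelP (parent x) k → LevelP x (suc k)

-- A spanning out-tree T of D with root r: every non-root vertex x has a
-- unique in-arc (parent x , x) of T, which must be an arc of D; the root
-- has in-degree 0.  The arc set of T is {(parent x , x) | x ≢ root}.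
-- Every vertex is reached from the root by a T-path, so T is spanning,
-- connected and acyclic (an out-tree).
record SpanningOutTree {n : ℕ} (D : Digraph n) : Set where
  field
    root      : Fin n
    parent    : Fin n → Fin n
    parentArc : ∀ x → x ≢ root → Arc D (parent x) x
    spanning  : ∀ x → AncP root parent root x

Anc : ∀ {n} {D : Digraph n} → SpanningOutTree D → Fin n → Fin n → Set
Anc T = AncP (SpanningOutTree.root T) (SpanningOutTree.parent T)

Level : ∀ {n} {D : Digraph n} → SpanningOutTree D → Fin n → ℕ → Set
Level T = LevelP (SpanningOutTree.root T) (SpanningOutTree.parent T)

open SpanningOutTree public

Final : ∀ {n} {D : Digraph n} → SpanningOutTree D → Set
Final {n} {D} T =
  ∀ (x y : Fin n) → Arc D x y →
  ∀ (kx ky : ℕ) → Level T x kx → Level T y ky → ¬ (kx < ky) →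
  Anc T y x

{-# OPTIONS --safe #-}
module Submission where

-- Among the spanning out-trees of D with a fixed root, take one maximising the
-- sum of all levels, which is bounded since every level is at most n.  If (x , y)
-- were a backward arc with y not an ancestor of x, making x the parent of y would
-- keep T an out-tree, raise the level of y and lower no level, contradicting
-- maximality.  Constructively, the maximum is reached by iterating this
-- improvement, which terminates because the sum is bounded.

open import Defs
open import Data.Bool using (true) renaming (_≟_ to _≟ᵇ_)
open import Data.Fin using (Fin; zero; suc; toℕ; _≟_)
open import Data.Fin.Properties using (toℕ-injective; toℕ<n; injective⇒≤; any?)
open import Data.Nat using (ℕ; zero; suc; _∸_; _≤_; _<_; _≤?_; s≤s)
open import Data.Nat.Induction using (<-wellFounded)
open import Data.Nat.Properties
  using ( ≤-refl; ≤-trans; ≤-reflexive; m≤n⇒m≤1+n; ≮⇒≥; <⇒≤; ∸-cancelˡ-≡; ∸-monoʳ-<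
        ; +-mono-≤; +-mono-<-≤; +-mono-≤-<; +-0-monoid)
open import Data.Product using (∃; ∃₂; Σ; _×_; _,_; proj₁; proj₂)
open import Data.Vec.Functional using (Vector; updateAt)
open import Data.Vec.Functional.Properties using (updateAt-updates; updateAt-minimal)
open import Function using (const)
open import Induction.WellFounded using (Acc; acc)
open import Relation.Nullary using (Dec; yes; no; ¬_; _×-dec_; ¬?; contradiction)
open import Relation.Binary.PropositionalEquality using (_≡_; _≢_; refl; sym; subst; subst₂; cong)

open import Algebra.Properties.Monoid.Sum +-0-monoid using (sum)

sum-mono-≤ : ∀ {m} {f g : Vector ℕ m} → (∀ i → f i ≤ g i) → sum f ≤ sum g
sum-mono-≤ {zero}  f≤g = ≤-refl
sum-mono-≤ {suc m} f≤g = +-mono-≤ (f≤g zero) (sum-mono-≤ (λ i → f≤g (suc i)))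

sum-mono-< : ∀ {m} {f g : Vector ℕ m} → (∀ i → f i ≤ g i) → ∀ j → f j < g j → sum f < sum g
sum-mono-< f≤g zero    fj<gj = +-mono-<-≤ fj<gj (sum-mono-≤ (λ i → f≤g (suc i)))
sum-mono-< f≤g (suc j) fj<gj = +-mono-≤-< (f≤g zero) (sum-mono-< (λ i → f≤g (suc i)) j fj<gj)

module _ {n : ℕ} {r : Fin n} {parent : Fin n → Fin n} where

  LevelP-functional : ∀ {x k k′} → LevelP r parent x k → LevelP r parent x k′ → k ≡ k′
  LevelP-functional lroot        lroot         = refl
  LevelP-functional lroot        (lstep x≢r _) = contradiction refl x≢r
  LevelP-functional (lstep x≢r _) lroot        = contradiction refl x≢r
  LevelP-functional (lstep _ L)  (lstep _ L′)  = cong suc (LevelP-functional L L′)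

  AncP⇒LevelP : ∀ {x} → AncP r parent r x → ∃ (LevelP r parent x)
  AncP⇒LevelP here         = 1 , lroot
  AncP⇒LevelP (step x≢r a) = let k , L = AncP⇒LevelP a in suc k , lstep x≢r L

  LevelP⇒AncP : ∀ {x k} → LevelP r parent x k → AncP r parent r x
  LevelP⇒AncP lroot         = here
  LevelP⇒AncP (lstep x≢r L) = step x≢r (LevelP⇒AncP L)

  ancestor? : ∀ y {x k} → LevelP r parent x k → Dec (AncP r parent y x)
  ancestor? y {x} L with y ≟ x
  ... | yes refl = yes here
  ancestor? y lroot | no y≢r = no λ { here → y≢r refl ; (step r≢r _) → r≢r refl }
  ancestor? y (lstep x≢r L) | no y≢x with ancestor? y L
  ... | yes a = yes (step x≢r a)
  ... | no ¬a = no λ { here → y≢x refl ; (step _ a) → ¬a a }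

  LevelP⇒≤ : ∀ {x k} → LevelP r parent x k → k ≤ n
  LevelP⇒≤ {x} {k} L = injective⇒≤ {f = λ i → ancestorAt (toℕ i) x} injective
    where
    ancestorAt : ℕ → Fin n → Fin n
    ancestorAt zero    z = z
    ancestorAt (suc i) z = ancestorAt i (parent z)

    LevelP-ancestorAt : ∀ i {z l} → i < l →
      LevelP r parent z l → LevelP r parent (ancestorAt i z) (l ∸ i)
    LevelP-ancestorAt zero    _         L            = L
    LevelP-ancestorAt (suc i) (s≤s i<l) (lstep _ L) = LevelP-ancestorAt i i<l L

    -- the k vertices of the root–x path are distinct because their levels are
    injective : ∀ {i j : Fin k} → ancestorAt (toℕ i) x ≡ ancestorAt (toℕ j) x → i ≡ j
    injective {i} {j} same = toℕ-injective (∸-cancelˡ-≡ (<⇒≤ (toℕ<n i)) (<⇒≤ (toℕ<n j))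
      (LevelP-functional (LevelP-ancestorAt (toℕ i) (toℕ<n i) L)
                         (subst (λ z → LevelP r parent z _) (sym same)
                                (LevelP-ancestorAt (toℕ j) (toℕ<n j) L))))

reparent : ∀ {n} → (Fin n → Fin n) → Fin n → Fin n → (Fin n → Fin n)
reparent parent y x = updateAt parent y (const x)

module _ {n : ℕ} {r : Fin n} {parent : Fin n → Fin n} {x y : Fin n} where

  private
    parent′ : Fin n → Fin n
    parent′ = reparent parent y x

  LevelP-reparent-unaffected : ∀ {z k} → ¬ AncP r parent y z →
    LevelP r parent z k → LevelP r parent′ z k
  LevelP-reparent-unaffected y⋠z lroot = lroot
  LevelP-reparent-unaffected y⋠z (lstep z≢r L) =
    lstep z≢r (subst (λ w → LevelP r parent′ w _) (sym (updateAt-minimal _ y parent z≢y))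
                     (LevelP-reparent-unaffected (λ a → y⋠z (step z≢r a)) L))
    where
    z≢y : _ ≢ y
    z≢y refl = y⋠z here

  module _ (y⋠x : ¬ AncP r parent y x) {kx : ℕ} (Lx : LevelP r parent x kx) where

    LevelP-reparent-target : LevelP r parent′ y (suc kx)
    LevelP-reparent-target =
      lstep y≢r (subst (λ w → LevelP r parent′ w kx) (sym (updateAt-updates y parent))
                       (LevelP-reparent-unaffected y⋠x Lx))
      where
      y≢r : y ≢ r
      y≢r refl = y⋠x (LevelP⇒AncP Lx)

    LevelP-reparent-≥ : ∀ {ky} → LevelP r parent y ky → ky ≤ kx →
      ∀ {z k} → LevelP r parent z k → ∃ λ k′ → k ≤ k′ × LevelP r parent′ z k′
    LevelP-reparent-≥ Ly ky≤kx {z} L with z ≟ y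
    ... | yes refl =
      suc kx , m≤n⇒m≤1+n (≤-trans (≤-reflexive (LevelP-functional L Ly)) ky≤kx) , LevelP-reparent-target
    LevelP-reparent-≥ Ly ky≤kx lroot | no _ = 1 , ≤-refl , lroot
    LevelP-reparent-≥ Ly ky≤kx {z} (lstep z≢r L) | no z≢y =
      let k′ , k≤k′ , L′ = LevelP-reparent-≥ Ly ky≤kx L
      in suc k′ , s≤s k≤k′
       , lstep z≢r (subst (λ w → LevelP r parent′ w k′) (sym (updateAt-minimal z y parent z≢y)) L′)

module _ {n : ℕ} {D : Digraph n} where

  level : SpanningOutTree D → Fin n → ℕ
  level T z = proj₁ (AncP⇒LevelP (spanning T z))

  Level-level : ∀ T z → Level T z (level T z)
  Level-level T z = proj₂ (AncP⇒LevelP (spanning T z))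

  Level-functional : ∀ T {z k} → Level T z k → k ≡ level T z
  Level-functional T {z} L = LevelP-functional L (Level-level T z)

  potential : SpanningOutTree D → ℕ
  potential T = sum (level T)

  maxPotential : ℕ
  maxPotential = sum {n} (const n)

  potential≤max : ∀ T → potential T ≤ maxPotential
  potential≤max T = sum-mono-≤ (λ z → LevelP⇒≤ (Level-level T z))

  BadArc : SpanningOutTree D → Fin n → Fin n → Set
  BadArc T x y = Arc D x y × level T y ≤ level T x × ¬ Anc T y x

  badArc? : ∀ T x y → Dec (BadArc T x y)
  badArc? T x y =
    (D x y ≟ᵇ true) ×-dec (level T y ≤? level T x) ×-dec ¬? (ancestor? y (Level-level T x))

  noBadArc⇒Final : ∀ T → ¬ ∃₂ (BadArc T) → Final T
  noBadArc⇒Final T noBad x y xy kx ky Lx Ly kx≮ky with ancestor? y Lx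
  ... | yes y≼x = y≼x
  ... | no  y⋠x = contradiction (x , y , xy , ly≤lx , y⋠x) noBad
    where
    ly≤lx : level T y ≤ level T x
    ly≤lx = subst₂ _≤_ (Level-functional T Ly) (Level-functional T Lx) (≮⇒≥ kx≮ky)

  BadArc⇒improvement : ∀ T {x y} → BadArc T x y →
    Σ (SpanningOutTree D) λ T′ → potential T < potential T′
  BadArc⇒improvement T {x} {y} (xy , ly≤lx , y⋠x) = T′ , sum-mono-< level≤ y ly<l′y
    where
    grown : ∀ z → ∃ λ k′ → level T z ≤ k′ × LevelP (root T) (reparent (parent T) y x) z k′
    grown z = LevelP-reparent-≥ y⋠x (Level-level T x) (Level-level T y) ly≤lx (Level-level T z)

    parentArc′ : ∀ z → z ≢ root T → Arc D (reparent (parent T) y x z) z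
    parentArc′ z z≢r with z ≟ y
    ... | yes refl = subst (λ w → Arc D w y) (sym (updateAt-updates y (parent T))) xy
    ... | no  z≢y  =
      subst (λ w → Arc D w z) (sym (updateAt-minimal z y (parent T) z≢y)) (parentArc T z z≢r)

    T′ : SpanningOutTree D
    T′ = record
      { root      = root T
      ; parent    = reparent (parent T) y x
      ; parentArc = parentArc′
      ; spanning  = λ z → LevelP⇒AncP (proj₂ (proj₂ (grown z)))
      }

    level≤ : ∀ z → level T z ≤ level T′ z
    level≤ z = let _ , l≤k′ , L′ = grown z in ≤-trans l≤k′ (≤-reflexive (Level-functional T′ L′))

    ly<l′y : level T y < level T′ y
    ly<l′y = ≤-trans (s≤s ly≤lx)
      (≤-reflexive (Level-functional T′ (LevelP-reparent-target y⋠x (Level-level T x))))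

  finalOutTree : ∀ T → Acc _<_ (maxPotential ∸ potential T) → Σ (SpanningOutTree D) Final
  finalOutTree T (acc rec) with any? (λ x → any? (badArc? T x))
  ... | no  noBad = T , noBadArc⇒Final T noBad
  ... | yes (x , y , bad) =
    let T′ , p<p′ = BadArc⇒improvement T bad
    in finalOutTree T′ (rec (∸-monoʳ-< p<p′ (potential≤max T′)))

proposition1 : (n : ℕ) (D : Digraph n) → SpanningOutTree D →
    Σ (SpanningOutTree D) Final
proposition1 n D T = finalOutTree T (<-wellFounded _)
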